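{- Let $(H,\omega)$ be an edge-weighted graph with positive integer weights and let $(G,\mathcal S)=(G(H,\omega),\mathcal S(H,\omega))$. Let $(A,B)$ be an $\mathcal S$-cut of $G$, and let $uv,xy\in E(H)$ with $I(u,v)\subseteq A$ and $I(x,y)\subseteq B$. If some vertex of $I(u,v)$ and some vertex of $I(x,y)$ are not joined by a dummy edge, then $u=y$ or $v=x$ or $v=y$.
   Context: Construction of $(G(H,\omega),\mathcal S(H,\omega))$: for each ordered pair $(u,v)$ with $uv\in E(H)$, add an independent set $I(u,v)$ of $\omega(uv)$ new vertices; let $S(u)=\bigcup_{v\in N_H(u)}I(u,v)$ and $\mathcal S=\{S(u):u\in V(H)\}$. Dummy edges: for every two edges $uv,xy$ of $H$ sharing no endpoint, every vertex of $I(u,v)$ is joined to every vertex of $I(x,y)$ (for all orientations of the two edges). Matching edges: for every $uv\in E(H)$, a perfect matching between $I(u,v)$ and $I(v,u)$. These are all the edges of $G$. An $\mathcal S$-cut is a bipartition $(A,B)$ of $V(G)$ such that each part of $\mathcal S$ is contained in $A$ or in $B$. -}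

module Defs where

open import Data.Nat using (ℕ; _<_)
open import Data.Fin using (Fin; toℕ)
open import Data.Bool using (Bool; true; false; T)
open import Data.Product using (_×_; Σ; _,_)
open import Data.Sum using (_⊎_)
open import Relation.Nullary using (¬_)
open import Relation.Binary.PropositionalEquality using (_≡_; _≢_; subst)

record WGraph (n : ℕ) : Set where
  field
    adj    : Fin n → Fin n → Bool
    adj-sym : ∀ u v → adj u v ≡ adj v u
    adj-irr : ∀ u → adj u u ≡ false
    ω      : Fin n → Fin n → ℕ
    ω-sym  : ∀ u v → ω u v ≡ ω v u
    ω-pos  : ∀ u v → T (adj u v) → 0 < ω u v

module _ {n : ℕ} (H : WGraph n) where
  open WGraph H

  -- Vertices of G(H,ω): the vertex number idx of I(src,tgt), for an edge src-tgt of H.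
  record GV : Set where
    constructor gv
    field
      src  : Fin n
      tgt  : Fin n
      edge : T (adj src tgt)
      idx  : Fin (ω src tgt)
  open GV public

  InI : Fin n → Fin n → GV → Set
  InI u v a = (src a ≡ u) × (tgt a ≡ v)

  InS : Fin n → GV → Set
  InS u a = src a ≡ u

  DummyEdge : GV → GV → Set
  DummyEdge a b =
    (src a ≢ src b) × (src a ≢ tgt b) × (tgt a ≢ src b) × (tgt a ≢ tgt b)

  -- Matching edges: the perfect matching between I(u,v) and I(v,u) pairing equal indices
  -- (well defined since ω(uv) = ω(vu)).
  MatchingEdge : GV → GV → Set
  MatchingEdge a b = (src a ≡ tgt b) × (tgt a ≡ src b) × (toℕ (idx a) ≡ toℕ (idx b))

  GEdge : GV → GV → Set
  GEdge a b = DummyEdge a b ⊎ MatchingEdge a b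

  -- A bipartition (A,B) of V(G) is given by side : GV → Bool, with A = side⁻¹(true), B = side⁻¹(false).
  -- It is an S-cut if every S(u) is contained in A or contained in B.
  IsSCut : (GV → Bool) → Set
  IsSCut side = ∀ u → (∀ a → InS u a → side a ≡ true) ⊎ (∀ a → InS u a → side a ≡ false)

{-# OPTIONS --safe #-}
module Submission where

open import Defs
open import Data.Nat using (ℕ)
open import Data.Fin using (Fin; _≟_)
open import Data.Bool using (Bool; true; false; T)
open import Data.Product using (_×_; Σ; _,_)
open import Data.Sum using (_⊎_; inj₁; inj₂)
open import Relation.Nullary using (¬_; yes; no)
open import Relation.Binary.PropositionalEquality using (_≡_; _≢_; refl; sym; trans)

module _ {n : ℕ} {H : WGraph n} where

  IsSCut⇒src≡⇒side≡ : ∀ {side} → IsSCut H side →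
                       ∀ {a b} → src a ≡ src b → side a ≡ side b
  IsSCut⇒src≡⇒side≡ cut {a} {b} src≡ with cut (src a)
  ... | inj₁ inA = trans (inA a refl) (sym (inA b (sym src≡)))
  ... | inj₂ inB = trans (inB a refl) (sym (inB b (sym src≡)))

  IsSCut⇒side-separates-src : ∀ {side} → IsSCut H side → ∀ {a b} →
                              side a ≡ true → side b ≡ false → src a ≢ src b
  IsSCut⇒side-separates-src cut a∈A b∈B src≡
    with () ← trans (sym a∈A) (trans (IsSCut⇒src≡⇒side≡ cut src≡) b∈B)

  ¬DummyEdge⇒shared-endpoint : ∀ a b → ¬ DummyEdge H a b →
    src a ≡ src b ⊎ src a ≡ tgt b ⊎ tgt a ≡ src b ⊎ tgt a ≡ tgt b
  ¬DummyEdge⇒shared-endpoint a b ¬dummy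
    with src a ≟ src b | src a ≟ tgt b | tgt a ≟ src b | tgt a ≟ tgt b
  ... | yes ss | _      | _      | _      = inj₁ ss
  ... | no _   | yes st | _      | _      = inj₂ (inj₁ st)
  ... | no _   | no _   | yes ts | _      = inj₂ (inj₂ (inj₁ ts))
  ... | no _   | no _   | no _   | yes tt = inj₂ (inj₂ (inj₂ tt))
  ... | no ss  | no st  | no ts  | no tt  with () ← ¬dummy (ss , st , ts , tt)

lemma18 : (n : ℕ) (H : WGraph n) (side : GV H → Bool) → IsSCut H side →
    (u v x y : Fin n) → T (WGraph.adj H u v) → T (WGraph.adj H x y) →
    (∀ a → InI H u v a → side a ≡ true) →
    (∀ b → InI H x y b → side b ≡ false) →
    Σ (GV H) (λ a → Σ (GV H) (λ b → InI H u v a × InI H x y b × ¬ DummyEdge H a b)) →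
    (u ≡ y) ⊎ (v ≡ x) ⊎ (v ≡ y)
lemma18 n H side cut _ _ _ _ _ _ I⊆A I⊆B (a , b , (refl , refl) , (refl , refl) , ¬dummy)
  with ¬DummyEdge⇒shared-endpoint a b ¬dummy
... | inj₁ u≡x
  with () ← IsSCut⇒side-separates-src cut (I⊆A a (refl , refl)) (I⊆B b (refl , refl)) u≡x
... | inj₂ u≡y⊎v≡x⊎v≡y = u≡y⊎v≡x⊎v≡y
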